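{- Let $\mathbb{F}$ be a field and let $X=\{x_1,\ldots,x_n\}$, $Z=\{z_1,\ldots,z_n\}$ be disjoint sets of variables. Let $f(x_1,\ldots,x_n) \in \mathbb{F}\langle X \rangle$ and $g(z_1,\ldots, z_n, x_1,\ldots,x_n) \in \mathbb{F}\langle Z\cup X \rangle$. Assume that for every $h_1,\ldots, h_n \in \mathbb{F}\langle Z \rangle$ we have $g(z_1,\ldots, z_n, h_1,\ldots,h_n)= f(h_1,\ldots,h_n)$ as elements of $\mathbb{F}\langle Z \rangle$. Let $g^0(x_1,\ldots,x_n)=g(0,\ldots,0,x_1,\ldots,x_n) \in \mathbb{F}\langle X \rangle$, i.e. the part of $g$ consisting of the monomials in which no variable of $Z$ appears. Then $g^0(x_1,\ldots,x_n) = f(x_1,\ldots,x_n)$ as elements of $\mathbb{F}\langle X \rangle$.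
   Context: For a set of variables $Y$, $\mathbb{F}\langle Y\rangle$ denotes the ring of non-commutative polynomials over $\mathbb{F}$ in the non-commuting variables of $Y$: formal $\mathbb{F}$-linear combinations of words over the alphabet $Y$, with product of words given by concatenation, extended bilinearly. Substituting elements $h_i$ for the variables $x_i$ means evaluating each word by replacing each letter $x_i$ with $h_i$ and multiplying in order. -}

module Defs where

open import Data.Nat using (ℕ)
open import Level using (Level; _⊔_; suc)
open import Algebra.Bundles using (CommutativeRing)
open import Data.Fin using (Fin)
open import Data.Fin.Properties using () renaming (_≟_ to _≟F_)
open import Data.Sum using (_⊎_; inj₁; inj₂)
open import Data.Sum.Properties using (≡-dec)
open import Data.List using (List; []; _∷_; _++_; map; concatMap)
open import Data.List.Properties using () renaming (≡-dec to ≡-decL)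
open import Data.Product using (_×_; _,_; ∃)
open import Relation.Binary.PropositionalEquality using (_≡_)
open import Relation.Binary.Definitions using (DecidableEquality)
open import Relation.Nullary using (¬_; yes; no)

record Field (c ℓ : Level) : Set (suc (c ⊔ ℓ)) where
  field
    commutativeRing : CommutativeRing c ℓ
  open CommutativeRing commutativeRing public
  field
    0≉1     : ¬ (0# ≈ 1#)
    inverse : ∀ x → ¬ (x ≈ 0#) → ∃ λ y → (x * y) ≈ 1#

-- Variable sets used in the statement.
-- X = {x_1..x_n} and Z = {z_1..z_n} are both indexed by Fin n;
-- Z ∪ X is the disjoint union  Fin n ⊎ Fin n  (inj₁ i = z_i, inj₂ i = x_i).
module NCPoly {c ℓ} (𝔽 : Field c ℓ) where
  open Field 𝔽

  Word : Set → Set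
  Word V = List V

  -- A non-commutative polynomial in F⟨V⟩: a finite formal F-linear
  -- combination of words, represented by a list of (coefficient, word) terms.
  Poly : Set → Set c
  Poly V = List (Carrier × Word V)

  0ₚ : ∀ {V} → Poly V
  0ₚ = []

  1ₚ : ∀ {V} → Poly V
  1ₚ = (1# , []) ∷ []

  var : ∀ {V} → V → Poly V
  var v = (1# , v ∷ []) ∷ []

  _+ₚ_ : ∀ {V} → Poly V → Poly V → Poly V
  p +ₚ q = p ++ q

  _*ₚ_ : ∀ {V} → Poly V → Poly V → Poly V
  p *ₚ q = concatMap (λ { (a , u) → map (λ { (b , w) → (a * b , u ++ w) }) q }) p

  scale : ∀ {V} → Carrier → Poly V → Poly V
  scale a p = map (λ { (b , w) → (a * b , w) }) p

  coeff : ∀ {V} → DecidableEquality V → Poly V → Word V → Carrier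
  coeff _≟_ [] w = 0#
  coeff _≟_ ((a , u) ∷ p) w with ≡-decL _≟_ u w
  ... | yes _ = a + coeff _≟_ p w
  ... | no  _ = coeff _≟_ p w

  PolyEq : ∀ {V} → DecidableEquality V → Poly V → Poly V → Set ℓ
  PolyEq _≟_ p q = ∀ w → coeff _≟_ p w ≈ coeff _≟_ q w

  evalWord : ∀ {V W} → (V → Poly W) → Word V → Poly W
  evalWord h []      = 1ₚ
  evalWord h (v ∷ w) = h v *ₚ evalWord h w

  subst : ∀ {V W} → Poly V → (V → Poly W) → Poly W
  subst [] h = 0ₚ
  subst ((a , w) ∷ p) h = scale a (evalWord h w) +ₚ subst p h

  _≃_ : ∀ {n} → Poly (Fin n) → Poly (Fin n) → Set ℓ
  _≃_ = PolyEq _≟F_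

{-# OPTIONS --safe #-}
-- Substitute x i ↦ z i ^ (N + 1), where N bounds the lengths of the words of g.  Each
-- substitution used sends every variable to a single word or to 0, so the coefficient of a
-- word u in p(h) is the sum of the coefficients of the words of p that h maps to u.  A word
-- of g without z-letters, read as a word w in the x's, goes to w with every letter repeated
-- N + 1 times, which is also the image of w in f(h); a word of g with m z-letters, 0 < m ≤ N,
-- goes to a word whose length is m modulo N + 1, so it is no such stretched word.  Comparing
-- coefficients of stretched words in g(z, h) = f(h) therefore gives g⁰ = f.
module Submission where

open import Defs
open import Level using (_⊔_)
open import Data.Nat using (ℕ; suc; _≤_)
open import Data.Fin using (Fin)
open import Data.Fin.Properties using () renaming (_≟_ to _≟F_)
open import Data.Sum using (_⊎_; inj₁; inj₂; [_,_])
open import Data.Product using (_,_; proj₁; proj₂)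
open import Data.Maybe using (Maybe; just; nothing; zipWith)
open import Data.Maybe.Properties using (just-injective) renaming (≡-dec to ≡-decM)
open import Data.List
  using (List; []; _∷_; _++_; length; replicate; map; concatMap; partitionSums)
open import Data.List.Properties
  using (length-++; length-replicate; ∷-injectiveˡ; ++-cancelˡ; concatMap-map)
  renaming (≡-dec to ≡-decL)
open import Data.List.Extrema.Nat using (max; xs≤max)
open import Data.List.Relation.Unary.All as All using (All; []; _∷_)
open import Data.List.Relation.Unary.All.Properties using (map⁻)
open import Data.Empty using (⊥-elim)
open import Function using (_∘_; _⇔_; mk⇔; Injective; Equivalence)
open import Relation.Binary.Definitions using (DecidableEquality)
open import Relation.Nullary using (yes; no)
open import Relation.Binary.PropositionalEquality
  using (_≡_; _≢_; refl; cong; cong₂; sym; module ≡-Reasoning)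
import Relation.Binary.Reasoning.Setoid as SetoidReasoning

module Words where
  open import Algebra.Properties.CommutativeSemigroup using (x∙yz≈y∙xz)
  open import Data.Nat using (_+_; _*_; _%_; _<_; z≤n; s≤s)
  open import Data.Nat.Properties using (+-commutativeSemigroup; <⇒≢; ≤-trans; m≤n⇒m≤1+n)
  open import Data.Nat.DivMod using ([m+kn]%n≡m%n; m*n%n≡0; m<n⇒m%n≡m)

  m+jn≡ln⇒m≡0 : ∀ m j l k → m < suc k → m + j * suc k ≡ l * suc k → m ≡ 0
  m+jn≡ln⇒m≡0 m j l k m<1+k eq = begin
    m                       ≡⟨ m<n⇒m%n≡m m<1+k ⟨
    m % suc k               ≡⟨ [m+kn]%n≡m%n m j (suc k) ⟨
    (m + j * suc k) % suc k ≡⟨ cong (_% suc k) eq ⟩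
    (l * suc k) % suc k     ≡⟨ m*n%n≡0 l (suc k) ⟩
    0                       ∎
    where open ≡-Reasoning

  module _ {A : Set} where

    stretch : ℕ → List A → List A
    stretch k = concatMap (replicate (suc k))

    length-stretch : ∀ k u → length (stretch k u) ≡ length u * suc k
    length-stretch k []      = refl
    length-stretch k (a ∷ u) = begin
      length (replicate (suc k) a ++ stretch k u)
        ≡⟨ length-++ (replicate (suc k) a) ⟩
      length (replicate (suc k) a) + length (stretch k u)
        ≡⟨ cong₂ _+_ (length-replicate (suc k)) (length-stretch k u) ⟩
      suc k + length u * suc k
        ∎
      where open ≡-Reasoning

    stretch-injective : ∀ k → Injective _≡_ _≡_ (stretch k)
    stretch-injective k {[]}    {[]}    _  = refl
    stretch-injective k {a ∷ u} {b ∷ v} eq with ∷-injectiveˡ eq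
    ... | refl = cong (a ∷_) (stretch-injective k (++-cancelˡ (replicate (suc k) a) _ _ eq))

  module _ {A B : Set} where

    count₁ count₂ : List (A ⊎ B) → ℕ
    count₁ = length ∘ proj₁ ∘ partitionSums
    count₂ = length ∘ proj₂ ∘ partitionSums

    count₁≤length : ∀ w → count₁ w ≤ length w
    count₁≤length []          = z≤n
    count₁≤length (inj₁ _ ∷ w) = s≤s (count₁≤length w)
    count₁≤length (inj₂ _ ∷ w) = m≤n⇒m≤1+n (count₁≤length w)

  imageWord : {V W : Set} → (V → Maybe (List W)) → List V → Maybe (List W)
  imageWord σ []      = just []
  imageWord σ (v ∷ w) = zipWith _++_ (σ v) (imageWord σ w)

  imageWord-just : {V W : Set} (ρ : V → List W) →
    ∀ w → imageWord (just ∘ ρ) w ≡ just (concatMap ρ w)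
  imageWord-just ρ []      = refl
  imageWord-just ρ (v ∷ w) = cong (zipWith _++_ (just (ρ v))) (imageWord-just ρ w)

  module _ {A B : Set} where

    zeroInj₁ : A ⊎ B → Maybe (List B)
    zeroInj₁ = [ (λ _ → nothing) , just ∘ (_∷ []) ]

    imageWord-zeroInj₁-just : ∀ {u} w → imageWord zeroInj₁ w ≡ just u → w ≡ map inj₂ u
    imageWord-zeroInj₁-just []           refl = refl
    imageWord-zeroInj₁-just (inj₁ _ ∷ w) ()
    imageWord-zeroInj₁-just (inj₂ b ∷ w) eq with imageWord zeroInj₁ w in eqw
    imageWord-zeroInj₁-just (inj₂ b ∷ w) refl | just _ =
      cong (inj₂ b ∷_) (imageWord-zeroInj₁-just w eqw)

    imageWord-zeroInj₁-nothing : ∀ w → imageWord zeroInj₁ w ≡ nothing → 0 < count₁ w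
    imageWord-zeroInj₁-nothing []           ()
    imageWord-zeroInj₁-nothing (inj₁ _ ∷ w) _  = s≤s z≤n
    imageWord-zeroInj₁-nothing (inj₂ b ∷ w) eq with imageWord zeroInj₁ w in eqw
    ... | nothing = imageWord-zeroInj₁-nothing w eqw

  module _ {A : Set} where

    stretchInj₂ : ℕ → A ⊎ A → List A
    stretchInj₂ k = [ (_∷ []) , replicate (suc k) ]

    length-concatMap-stretchInj₂ : ∀ k w →
      length (concatMap (stretchInj₂ k) w) ≡ count₁ w + count₂ w * suc k
    length-concatMap-stretchInj₂ k []           = refl
    length-concatMap-stretchInj₂ k (inj₁ _ ∷ w) = cong suc (length-concatMap-stretchInj₂ k w)
    length-concatMap-stretchInj₂ k (inj₂ a ∷ w) = begin
      length (replicate (suc k) a ++ concatMap (stretchInj₂ k) w)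
        ≡⟨ length-++ (replicate (suc k) a) ⟩
      length (replicate (suc k) a) + length (concatMap (stretchInj₂ k) w)
        ≡⟨ cong₂ _+_ (length-replicate (suc k)) (length-concatMap-stretchInj₂ k w) ⟩
      suc k + (count₁ w + count₂ w * suc k)
        ≡⟨ x∙yz≈y∙xz +-commutativeSemigroup (suc k) (count₁ w) (count₂ w * suc k) ⟩
      count₁ w + (suc k + count₂ w * suc k)
        ∎
      where open ≡-Reasoning

    -- Modulo k + 1, the left-hand side has length count₁ w and the right-hand side length 0.
    concatMap-stretchInj₂≢stretch : ∀ {k} u w → 0 < count₁ w → count₁ w ≤ k →
      concatMap (stretchInj₂ k) w ≢ stretch k u
    concatMap-stretchInj₂≢stretch {k} u w 0<count₁ count₁≤k eq =
      <⇒≢ 0<count₁ (sym (m+jn≡ln⇒m≡0 (count₁ w) (count₂ w) (length u) k (s≤s count₁≤k) (begin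
        count₁ w + count₂ w * suc k          ≡⟨ length-concatMap-stretchInj₂ k w ⟨
        length (concatMap (stretchInj₂ k) w) ≡⟨ cong length eq ⟩
        length (stretch k u)                 ≡⟨ length-stretch k u ⟩
        length u * suc k                     ∎)))
      where open ≡-Reasoning

    zeroInj₁⇔stretchInj₂ : ∀ {k u} w → length w ≤ k →
      imageWord zeroInj₁ w ≡ just u ⇔ imageWord (just ∘ stretchInj₂ k) w ≡ just (stretch k u)
    zeroInj₁⇔stretchInj₂ {k} {u} w |w|≤k rewrite imageWord-just (stretchInj₂ k) w
      with imageWord zeroInj₁ w in eqw
    ... | just v rewrite imageWord-zeroInj₁-just w eqw | concatMap-map (stretchInj₂ k) inj₂ v =
      mk⇔ (cong (just ∘ stretch k) ∘ just-injective)
          (cong just ∘ stretch-injective k ∘ just-injective)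
    ... | nothing = mk⇔ (λ ())
      (⊥-elim ∘ concatMap-stretchInj₂≢stretch u w (imageWord-zeroInj₁-nothing w eqw)
                  (≤-trans (count₁≤length w) |w|≤k) ∘ just-injective)

  imageWord-stretch⇔ : ∀ {A : Set} {k} {u : List A} w →
    imageWord (just ∘ replicate (suc k)) w ≡ just (stretch k u) ⇔ just w ≡ just u
  imageWord-stretch⇔ {k = k} w rewrite imageWord-just (replicate (suc k)) w =
    mk⇔ (cong just ∘ stretch-injective k ∘ just-injective)
        (cong (just ∘ stretch k) ∘ just-injective)

open Words

module MonomialSubstitution {c ℓ} (𝔽 : Field c ℓ) where
  open Field 𝔽
    using (Carrier; _≈_; _+_; 0#; 1#; +-cong; *-cong;
           +-assoc; +-identityˡ; +-identityʳ; *-identityˡ; *-identityʳ)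
    renaming (refl to ≈-refl; sym to ≈-sym; trans to ≈-trans)
  open NCPoly 𝔽 using (Poly; Word; coeff; scale; evalWord; subst; _*ₚ_)

  monomial : ∀ {W} → Word W → Poly W
  monomial t = (1# , t) ∷ []

  -- nothing encodes the zero polynomial; the coefficient is 1 only up to ≈.
  data IsMonomial {W : Set} : Maybe (Word W) → Poly W → Set (c ⊔ ℓ) where
    zero  : IsMonomial nothing []
    monic : ∀ {e t} → e ≈ 1# → IsMonomial (just t) ((e , t) ∷ [])

  *ₚ-isMonomial : ∀ {W} {m m′ : Maybe (Word W)} {p q} →
    IsMonomial m p → IsMonomial m′ q → IsMonomial (zipWith _++_ m m′) (p *ₚ q)
  *ₚ-isMonomial zero        _           = zero
  *ₚ-isMonomial (monic _)   zero        = zero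
  *ₚ-isMonomial (monic e≈1) (monic f≈1) = monic (≈-trans (*-cong e≈1 f≈1) (*-identityˡ 1#))

  evalWord-isMonomial : ∀ {V W} {σ : V → Maybe (Word W)} {h : V → Poly W} →
    (∀ v → IsMonomial (σ v) (h v)) → ∀ w → IsMonomial (imageWord σ w) (evalWord h w)
  evalWord-isMonomial hσ []      = monic ≈-refl
  evalWord-isMonomial hσ (v ∷ w) = *ₚ-isMonomial (hσ v) (evalWord-isMonomial hσ w)

  module _ {W : Set} (_≟_ : DecidableEquality W) where

    coeff-++ : ∀ (p q : Poly W) u → coeff _≟_ (p ++ q) u ≈ coeff _≟_ p u + coeff _≟_ q u
    coeff-++ []            q u = ≈-sym (+-identityˡ _)
    coeff-++ ((a , t) ∷ p) q u with ≡-decL _≟_ t u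
    ... | yes _ = ≈-trans (+-cong ≈-refl (coeff-++ p q u)) (≈-sym (+-assoc _ _ _))
    ... | no  _ = coeff-++ p q u

    coeff-scale-isMonomial-≡ : ∀ {m E u} a → IsMonomial m E → m ≡ just u →
      coeff _≟_ (scale a E) u ≈ a
    coeff-scale-isMonomial-≡ {u = u} a (monic e≈1) refl with ≡-decL _≟_ u u
    ... | yes _   = ≈-trans (+-identityʳ _) (≈-trans (*-cong ≈-refl e≈1) (*-identityʳ a))
    ... | no  u≢u = ⊥-elim (u≢u refl)

    coeff-scale-isMonomial-≢ : ∀ {m E u} a → IsMonomial m E → m ≢ just u →
      coeff _≟_ (scale a E) u ≈ 0#
    coeff-scale-isMonomial-≢         a zero                _  = ≈-refl
    coeff-scale-isMonomial-≢ {u = u} a (monic {t = t} _) m≢u with ≡-decL _≟_ t u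
    ... | yes t≡u = ⊥-elim (m≢u (cong just t≡u))
    ... | no  _   = ≈-refl

    coeffUnder : ∀ {V} → (Word V → Maybe (Word W)) → Poly V → Word W → Carrier
    coeffUnder φ []            u = 0#
    coeffUnder φ ((a , w) ∷ p) u with ≡-decM (≡-decL _≟_) (φ w) (just u)
    ... | yes _ = a + coeffUnder φ p u
    ... | no  _ = coeffUnder φ p u

    coeff-subst-isMonomial : ∀ {V} {σ : V → Maybe (Word W)} {h : V → Poly W} →
      (∀ v → IsMonomial (σ v) (h v)) →
      ∀ p u → coeff _≟_ (subst p h) u ≈ coeffUnder (imageWord σ) p u
    coeff-subst-isMonomial hσ []            u = ≈-refl
    coeff-subst-isMonomial {σ = σ} {h} hσ ((a , w) ∷ p) u
      with ≡-decM (≡-decL _≟_) (imageWord σ w) (just u)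
    ... | yes σw≡u = ≈-trans (coeff-++ (scale a (evalWord h w)) (subst p h) u)
      (+-cong (coeff-scale-isMonomial-≡ a (evalWord-isMonomial hσ w) σw≡u)
              (coeff-subst-isMonomial hσ p u))
    ... | no  σw≢u = ≈-trans (coeff-++ (scale a (evalWord h w)) (subst p h) u)
      (≈-trans (+-cong (coeff-scale-isMonomial-≢ a (evalWord-isMonomial hσ w) σw≢u)
                       (coeff-subst-isMonomial hσ p u))
               (+-identityˡ _))

    coeff≈coeffUnder-just : ∀ p u → coeff _≟_ p u ≈ coeffUnder just p u
    coeff≈coeffUnder-just []            u = ≈-refl
    coeff≈coeffUnder-just ((a , w) ∷ p) u
      with ≡-decL _≟_ w u | ≡-decM (≡-decL _≟_) (just w) (just u)
    ... | yes _   | yes _   = +-cong ≈-refl (coeff≈coeffUnder-just p u)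
    ... | no  _   | no  _   = coeff≈coeffUnder-just p u
    ... | yes w≡u | no  w≢u = ⊥-elim (w≢u (cong just w≡u))
    ... | no  w≢u | yes w≡u = ⊥-elim (w≢u (just-injective w≡u))

  coeffUnder-cong : ∀ {V W W′} (_≟_ : DecidableEquality W) (_≟′_ : DecidableEquality W′)
    {φ : Word V → Maybe (Word W)} {φ′ : Word V → Maybe (Word W′)} {u u′} {p} →
    All (λ (_ , w) → φ w ≡ just u ⇔ φ′ w ≡ just u′) p →
    coeffUnder _≟_ φ p u ≈ coeffUnder _≟′_ φ′ p u′
  coeffUnder-cong _≟_ _≟′_ [] = ≈-refl
  coeffUnder-cong _≟_ _≟′_ {φ} {φ′} {u} {u′} {(a , w) ∷ p} (φw⇔φ′w ∷ rest)
    with ≡-decM (≡-decL _≟_) (φ w) (just u) | ≡-decM (≡-decL _≟′_) (φ′ w) (just u′)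
  ... | yes _  | yes _   = +-cong ≈-refl (coeffUnder-cong _≟_ _≟′_ rest)
  ... | no  _  | no  _   = coeffUnder-cong _≟_ _≟′_ rest
  ... | yes e  | no  ¬e′ = ⊥-elim (¬e′ (Equivalence.to φw⇔φ′w e))
  ... | no  ¬e | yes e′  = ⊥-elim (¬e (Equivalence.from φw⇔φ′w e′))

lemma1 : ∀ {c ℓ} (𝔽 : Field c ℓ) (n : ℕ)
           (f : NCPoly.Poly 𝔽 (Fin n))
           (g : NCPoly.Poly 𝔽 (Fin n ⊎ Fin n)) →
           ((h : Fin n → NCPoly.Poly 𝔽 (Fin n)) →
             NCPoly._≃_ 𝔽 (NCPoly.subst 𝔽 g [ NCPoly.var 𝔽 , h ])
                          (NCPoly.subst 𝔽 f h)) →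
           NCPoly._≃_ 𝔽 (NCPoly.subst 𝔽 g [ (λ _ → NCPoly.0ₚ 𝔽) , NCPoly.var 𝔽 ]) f
lemma1 𝔽 n f g hyp u = begin
  coeff _≟F_ (subst g [ (λ _ → 0ₚ) , var ]) u
    ≈⟨ coeff-subst-isMonomial _≟F_ (λ { (inj₁ _) → zero ; (inj₂ _) → monic ≈-refl }) g u ⟩
  coeffUnder _≟F_ (imageWord zeroInj₁) g u
    ≈⟨ coeffUnder-cong _≟F_ _≟F_ (All.map (λ {(_ , w)} → zeroInj₁⇔stretchInj₂ w) words-shorter) ⟩
  coeffUnder _≟F_ (imageWord (just ∘ stretchInj₂ N)) g (stretch N u)
    ≈⟨ coeff-subst-isMonomial _≟F_ (λ { (inj₁ _) → monic ≈-refl ; (inj₂ _) → monic ≈-refl }) g _ ⟨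
  coeff _≟F_ (subst g [ var , h ]) (stretch N u)
    ≈⟨ hyp h (stretch N u) ⟩
  coeff _≟F_ (subst f h) (stretch N u)
    ≈⟨ coeff-subst-isMonomial _≟F_ (λ _ → monic ≈-refl) f _ ⟩
  coeffUnder _≟F_ (imageWord (just ∘ replicate (suc N))) f (stretch N u)
    ≈⟨ coeffUnder-cong _≟F_ _≟F_ (All.universal (λ (_ , w) → imageWord-stretch⇔ w) f) ⟩
  coeffUnder _≟F_ just f u
    ≈⟨ coeff≈coeffUnder-just _≟F_ f u ⟨
  coeff _≟F_ f u
    ∎
  where
  open Field 𝔽 using (setoid) renaming (refl to ≈-refl)
  open NCPoly 𝔽 using (Poly; coeff; subst; var; 0ₚ)
  open MonomialSubstitution 𝔽
  open SetoidReasoning setoid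

  N : ℕ
  N = max 0 (map (length ∘ proj₂) g)

  words-shorter : All (λ (_ , w) → length w ≤ N) g
  words-shorter = map⁻ (xs≤max 0 (map (length ∘ proj₂) g))

  h : Fin n → Poly (Fin n)
  h i = monomial (replicate (suc N) i)
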